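{- For every $n\ge1$, the path on $n$ vertices is $123$-representable by a $2$-uniform word, i.e., for some labeling of its vertices by distinct elements of a totally ordered set it is represented by a $123$-avoiding word in which every letter occurs exactly twice.
   Context: A word is a finite sequence of letters from a totally ordered alphabet. Two letters $x,y$ alternate in a word $w$ if between any two occurrences of $x$ there is an occurrence of $y$ and between any two occurrences of $y$ there is an occurrence of $x$. A graph $G=(V,E)$ is represented by a word $w$ over $V$ if for all distinct $x,y\in V$, $x$ and $y$ alternate in $w$ if and only if $xy\in E$. A word is $123$-avoiding if it has no strictly increasing subsequence of length $3$. -}

module Defs where

open import Data.Nat using (ℕ; suc; _<_)
open import Data.Fin using (Fin; toℕ)
open import Data.List using (List; length; lookup; filter)
open import Data.Product using (Σ; _×_; ∃-syntax)
open import Data.Sum using (_⊎_)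
open import Relation.Nullary using (¬_; Dec)
open import Relation.Binary.PropositionalEquality using (_≡_; _≢_)
open import Function.Definitions using (Injective)

Word : Set → Set
Word A = List A

Pos : {A : Set} → Word A → Set
Pos w = Fin (length w)

SeparatedBy : {A : Set} → Word A → A → A → Set
SeparatedBy w x y =
  (i j : Pos w) → toℕ i < toℕ j → lookup w i ≡ x → lookup w j ≡ x →
  ∃[ k ] (toℕ i < toℕ k × toℕ k < toℕ j × lookup w k ≡ y)

Alternate : {A : Set} → Word A → A → A → Set
Alternate w x y = SeparatedBy w x y × SeparatedBy w y x

Represents : {V : Set} → (E : V → V → Set) → Word V → Set
Represents {V} E w = (x y : V) → x ≢ y →
  (Alternate w x y → E x y) × (E x y → Alternate w x y)

PathEdge : (n : ℕ) → Fin n → Fin n → Set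
PathEdge n i j = suc (toℕ i) ≡ toℕ j ⊎ suc (toℕ j) ≡ toℕ i

-- 123-avoiding with respect to the order on letters induced by a labeling
-- lab : V → ℕ (letters compared via their labels).
Avoids123 : {V : Set} → (V → ℕ) → Word V → Set
Avoids123 lab w = ¬ (∃[ i ] ∃[ j ] ∃[ k ]
  (toℕ i < toℕ j × toℕ j < toℕ k ×
   lab (lookup w i) < lab (lookup w j) × lab (lookup w j) < lab (lookup w k)))

count : {V : Set} → ((a b : V) → Dec (a ≡ b)) → Word V → V → ℕ
count _≟_ w x = length (filter (λ a → a ≟ x) w)

TwoUniform : (n : ℕ) → Word (Fin n) → Set
TwoUniform n w = (x : Fin n) → count Data.Fin._≟_ w x ≡ 2

module Submission where

-- The path 0 - 1 - … - M is represented by the 2-uniform word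
--
--     0 1 0 2 1 3 2 … M (M-1) M ,
--
-- whose letter at position p is  rank p ⊓ M,  where rank is the sequence
-- 0 1 0 2 1 3 2 …  (rank 0 = 0, rank (2t+1) = t+1, rank (2t+2) = t).
-- Vertex g < M occurs exactly at positions 2g-1 (0 for g = 0) and 2g+2, the
-- top vertex M at 2M-1 and 2M+1.  With the order-reversing labels M - g
-- the word is 123-avoiding, because rank never drops by more than one later on.

open import Defs
open import Data.Nat using (ℕ; zero; suc; _+_; _∸_; _⊓_; _≤_; _<_; _≥_; z≤n; s≤s; _≤?_; _<?_)
open import Data.Nat.Properties
open import Data.Fin using (Fin; toℕ; fromℕ<) renaming (zero to fzero; suc to fsuc)
open import Data.Fin.Properties using (toℕ<n; toℕ-fromℕ<; toℕ-injective)
import Data.Fin as Fin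
open import Data.List using ([]; _∷_; lookup; applyUpTo)
open import Data.List.Properties using (length-applyUpTo; lookup-applyUpTo)
open import Data.Product using (Σ; ∃-syntax; _×_; _,_; proj₁; proj₂; swap)
open import Data.Sum using (_⊎_; inj₁; inj₂; [_,_]; map; map₂)
open import Data.Empty using (⊥; ⊥-elim)
open import Function using (_∘_)
open import Function.Definitions using (Injective)
open import Relation.Nullary using (¬_; yes; no)
open import Relation.Binary.Definitions using (DecidableEquality; tri<; tri≈; tri>)
open import Relation.Binary.PropositionalEquality using (_≡_; refl; sym; trans; cong; subst; subst₂; module ≡-Reasoning)

-- Letters occurring exactly twice in a word: alternation is decided by the
-- relative order of the occurrence positions.

module _ {A : Set} where

  OccursAt : Word A → A → ℕ → Set
  OccursAt w x p = Σ (Pos w) λ i → toℕ i ≡ p × lookup w i ≡ x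

  OnlyAt : Word A → A → (ℕ → Set) → Set
  OnlyAt w x P = (i : Pos w) → lookup w i ≡ x → P (toℕ i)

  record TwiceAt (w : Word A) (x : A) (a b : ℕ) : Set where
    constructor twiceAt
    field
      ordered : a < b
      at₁     : OccursAt w x a
      at₂     : OccursAt w x b
      only    : OnlyAt w x (λ p → p ≡ a ⊎ p ≡ b)

  open TwiceAt

  outermost : ∀ {w x a b} → TwiceAt w x a b → (i j : Pos w) → toℕ i < toℕ j →
              lookup w i ≡ x → lookup w j ≡ x → toℕ i ≡ a × toℕ j ≡ b
  outermost t i j i<j ix jx with only t i ix | only t j jx
  ... | inj₁ i≡a | inj₂ j≡b = i≡a , j≡b
  ... | inj₁ i≡a | inj₁ j≡a = ⊥-elim (<-irrefl (trans i≡a (sym j≡a)) i<j)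
  ... | inj₂ i≡b | inj₂ j≡b = ⊥-elim (<-irrefl (trans i≡b (sym j≡b)) i<j)
  ... | inj₂ i≡b | inj₁ j≡a = ⊥-elim (<-asym i<j (subst₂ _<_ (sym j≡a) (sym i≡b) (ordered t)))

  separated-if-between : ∀ {w x y a b c} → TwiceAt w x a b → OccursAt w y c →
                         a < c → c < b → SeparatedBy w x y
  separated-if-between t (k , k≡c , ky) a<c c<b i j i<j ix jx with outermost t i j i<j ix jx
  ... | i≡a , j≡b =
    k , subst₂ _<_ (sym i≡a) (sym k≡c) a<c , subst₂ _<_ (sym k≡c) (sym j≡b) c<b , ky

  alternate-if-interleaved : ∀ {w x y a b c d} → TwiceAt w x a b → TwiceAt w y c d →
                             a < c × c < b × b < d → Alternate w x y
  alternate-if-interleaved tx ty (a<c , c<b , b<d) =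
    separated-if-between tx (at₁ ty) a<c c<b , separated-if-between ty (at₂ tx) c<b b<d

  not-separated-if-before : ∀ {w x y a b c d} → TwiceAt w x a b → TwiceAt w y c d →
                            b < c → ¬ SeparatedBy w x y
  not-separated-if-before tx ty b<c sep with at₁ tx | at₂ tx
  ... | i , i≡a , ix | j , j≡b , jx
    with sep i j (subst₂ _<_ (sym i≡a) (sym j≡b) (ordered tx)) ix jx
  ... | k , _ , k<j , ky = <-irrefl refl (<-≤-trans (<-trans k<b b<c) c≤k)
    where
    k<b = subst (toℕ k <_) j≡b k<j
    c≤k = [ (λ k≡c → ≤-reflexive (sym k≡c))
          , (λ k≡d → subst (_ ≤_) (sym k≡d) (<⇒≤ (ordered ty))) ] (only ty k ky)

module _ {A : Set} (_≟_ : DecidableEquality A) where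

  open TwiceAt

  count-head-≡ : ∀ {y x} {w : Word A} → y ≡ x → count _≟_ (y ∷ w) x ≡ suc (count _≟_ w x)
  count-head-≡ {y} {x} y≡x with y ≟ x
  ... | yes _   = refl
  ... | no y≢x = ⊥-elim (y≢x y≡x)

  count-head-≢ : ∀ {y x} {w : Word A} → ¬ y ≡ x → count _≟_ (y ∷ w) x ≡ count _≟_ w x
  count-head-≢ {y} {x} y≢x with y ≟ x
  ... | yes y≡x = ⊥-elim (y≢x y≡x)
  ... | no _    = refl

  occurs-tail : ∀ {y x p} {w : Word A} → OccursAt (y ∷ w) x (suc p) → OccursAt w x p
  occurs-tail (fzero , () , _)
  occurs-tail (fsuc i , i≡p , ix) = i , suc-injective i≡p , ix

  count-none : ∀ {w : Word A} {x} → OnlyAt w x (λ _ → ⊥) → count _≟_ w x ≡ 0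
  count-none {[]} _ = refl
  count-none {y ∷ w} only = trans (count-head-≢ (only fzero)) (count-none {w} (only ∘ fsuc))

  count-once : ∀ {w : Word A} {x a} → OccursAt w x a → OnlyAt w x (_≡ a) → count _≟_ w x ≡ 1
  count-once {[]} (() , _) _
  count-once {y ∷ w} {a = zero} (fzero , _ , yx) only =
    trans (count-head-≡ yx) (cong suc (count-none {w} (λ i ix → 1+n≢0 (only (fsuc i) ix))))
  count-once {y ∷ w} {a = zero} (fsuc _ , () , _) _
  count-once {y ∷ w} {a = suc a} occ only =
    trans (count-head-≢ (λ yx → 0≢1+n (only fzero yx)))
          (count-once {w} (occurs-tail occ) (λ i ix → suc-injective (only (fsuc i) ix)))

  count-twice : ∀ {w : Word A} {x a b} → TwiceAt w x a b → count _≟_ w x ≡ 2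
  count-twice {[]} (twiceAt _ (() , _) _ _)
  count-twice {y ∷ w} {a = zero} (twiceAt _ (fsuc _ , () , _) _ _)
  count-twice {y ∷ w} {a = zero} {b = zero} (twiceAt () _ _ _)
  count-twice {y ∷ w} {a = zero} {b = suc b} (twiceAt _ (fzero , _ , yx) occ₂ only) =
    trans (count-head-≡ yx) (cong suc (count-once {w} (occurs-tail occ₂) only-b))
    where
    only-b : OnlyAt w _ (_≡ b)
    only-b i ix = [ (λ ()) , suc-injective ] (only (fsuc i) ix)
  count-twice {y ∷ w} {a = suc a} {b = zero} (twiceAt () _ _ _)
  count-twice {y ∷ w} {a = suc a} {b = suc b} t =
    trans (count-head-≢ (λ yx → [ 0≢1+n , 0≢1+n ] (only t fzero yx)))
          (count-twice {w} (twiceAt (≤-pred (ordered t)) (occurs-tail (at₁ t)) (occurs-tail (at₂ t))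
            (λ i ix → map suc-injective suc-injective (only t (fsuc i) ix))))

rank : ℕ → ℕ
rank zero                = 0
rank (suc zero)          = 1
rank (suc (suc zero))    = 0
rank (suc (suc (suc p))) = suc (rank (suc p))

rank-odd : ∀ t → rank (suc (t + t)) ≡ suc t
rank-odd zero = refl
rank-odd (suc t) rewrite +-suc t t = cong suc (rank-odd t)

rank-even : ∀ t → rank (suc (suc (t + t))) ≡ t
rank-even zero = refl
rank-even (suc t) rewrite +-suc t t = cong suc (rank-even t)

data Shape : ℕ → Set where
  origin : Shape 0
  odd    : ∀ t → Shape (suc (t + t))
  even   : ∀ t → Shape (suc (suc (t + t)))

shape : ∀ p → Shape p
shape zero = origin
shape (suc zero) = odd 0
shape (suc (suc p)) with shape p
... | origin = even 0
... | odd t  = subst Shape (cong (suc ∘ suc) (+-suc t t)) (odd (suc t))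
... | even t = subst Shape (cong (suc ∘ suc ∘ suc) (+-suc t t)) (even (suc t))

rank-first : ∀ u → rank ((u + u) ∸ 1) ≡ u
rank-first zero = refl
rank-first (suc u) rewrite +-suc u u = rank-odd u

rank-preimage : ∀ p u → rank p ≡ u → p ≡ (u + u) ∸ 1 ⊎ p ≡ suc (suc (u + u))
rank-preimage p u eq with shape p
... | origin = inj₁ (cong (λ v → (v + v) ∸ 1) eq)
... | odd t  = inj₁ (trans (sym (+-suc t t))
                           (cong (λ v → (v + v) ∸ 1) (trans (sym (rank-odd t)) eq)))
... | even t = inj₂ (cong (λ v → suc (suc (v + v))) (trans (sym (rank-even t)) eq))

rank-lower : ∀ p → rank p + rank p ≤ suc p
rank-lower p with shape p
... | origin = z≤n
... | odd t  rewrite rank-odd t  = ≤-reflexive (cong suc (+-suc t t))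
... | even t rewrite rank-even t = m≤n+m (t + t) 3

rank-upper : ∀ p → p ≤ suc (suc (rank p + rank p))
rank-upper p with shape p
... | origin = z≤n
... | odd t  rewrite rank-odd t | +-suc t t = m≤n+m (suc (t + t)) 3
... | even t rewrite rank-even t = ≤-refl

halve : ∀ {a b} → a + a ≤ suc (suc (b + b)) → a ≤ suc b
halve {a} {b} h with a ≤? suc b
... | yes a≤1+b = a≤1+b
... | no a≰1+b = ⊥-elim (<-irrefl refl (<-≤-trans 2b+2<2b+4 (≤-trans (+-mono-≤ b+2≤a b+2≤a) h)))
  where
  b+2≤a = ≰⇒> a≰1+b
  2b+2<2b+4 : suc (suc (b + b)) < suc (suc b) + suc (suc b)
  2b+2<2b+4 = s≤s (s≤s (+-monoʳ-< b (s≤s (n≤1+n b))))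

rank-dip : ∀ {i k} → i < k → rank i ≤ suc (rank k)
rank-dip {i} {k} i<k = halve (≤-trans (rank-lower i) (≤-trans i<k (rank-upper k)))

module PathWord (M : ℕ) where

  open TwiceAt

  Vertex : Set
  Vertex = Fin (suc M)

  vertexAt : ℕ → Vertex
  vertexAt p = fromℕ< (s≤s (m⊓n≤n (rank p) M))

  Len : ℕ
  Len = suc (suc (M + M))

  word : Word Vertex
  word = applyUpTo vertexAt Len

  toℕ-lookup : (i : Pos word) → toℕ (lookup word i) ≡ rank (toℕ i) ⊓ M
  toℕ-lookup i = trans (cong toℕ (lookup-applyUpTo vertexAt Len i)) (toℕ-fromℕ< _)

  pos<Len : (i : Pos word) → toℕ i < Len
  pos<Len i = subst (toℕ i <_) (length-applyUpTo vertexAt Len) (toℕ<n i)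

  -- The two positions of vertex g: 2g-1 and 2g+2, the latter capped at the
  -- last position 2M+1 for the top vertex.
  pos₁ pos₂ : ℕ → ℕ
  pos₁ g = (g + g) ∸ 1
  pos₂ g = suc (suc (g + g)) ⊓ suc (M + M)

  pos₂-inner : ∀ {g} → g < M → pos₂ g ≡ suc (suc (g + g))
  pos₂-inner {g} g<M = m≤n⇒m⊓n≡m (≤-trans 2g+2≤2M (n≤1+n (M + M)))
    where
    2g+2≤2M : suc (suc (g + g)) ≤ M + M
    2g+2≤2M = subst (_≤ M + M) (cong suc (+-suc g g)) (+-mono-≤ g<M g<M)

  pos₂-top : pos₂ M ≡ suc (M + M)
  pos₂-top = m≥n⇒m⊓n≡n (n≤1+n _)

  pos₂-lower : ∀ {g} → g ≤ M → suc (g + g) ≤ pos₂ g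
  pos₂-lower g≤M = ⊓-glb (n≤1+n _) (s≤s (+-mono-≤ g≤M g≤M))

  pos₂<Len : ∀ {g} → pos₂ g < Len
  pos₂<Len = m<n⇒o⊓m<n _ (n<1+n _)

  pos₁<pos₂ : ∀ {g} → g ≤ M → pos₁ g < pos₂ g
  pos₁<pos₂ {g} g≤M = <-≤-trans (s≤s (m∸n≤m (g + g) 1)) (pos₂-lower g≤M)

  vertex-pos₁ : ∀ {g} → g ≤ M → rank (pos₁ g) ⊓ M ≡ g
  vertex-pos₁ {g} g≤M = trans (cong (_⊓ M) (rank-first g)) (m≤n⇒m⊓n≡m g≤M)

  vertex-pos₂ : ∀ {g} → g ≤ M → rank (pos₂ g) ⊓ M ≡ g
  vertex-pos₂ {g} g≤M with m≤n⇒m<n∨m≡n g≤M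
  ... | inj₁ g<M rewrite pos₂-inner g<M | rank-even g = m≤n⇒m⊓n≡m g≤M
  ... | inj₂ refl rewrite pos₂-top | rank-odd M = m≥n⇒m⊓n≡n (n≤1+n M)

  inner-positions : ∀ p {g} → g < M → rank p ≡ g → p ≡ pos₁ g ⊎ p ≡ pos₂ g
  inner-positions p {g} g<M eq = map₂ (λ e → trans e (sym (pos₂-inner g<M))) (rank-preimage p g eq)

  -- Positions carrying the top vertex M: rank p is M or M+1 there.
  top-positions : ∀ p → p < Len → M ≤ rank p → p ≡ pos₁ M ⊎ p ≡ pos₂ M
  top-positions p p<Len M≤r with m≤n⇒m<n∨m≡n M≤r
  ... | inj₂ M≡r with rank-preimage p M (sym M≡r)
  ...   | inj₁ e = inj₁ e
  ...   | inj₂ e = ⊥-elim (<-irrefl e p<Len)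
  top-positions p p<Len M≤r | inj₁ M<r with rank-preimage p (suc M) r≡1+M
    where r≡1+M = ≤-antisym (halve (≤-trans (rank-lower p) p<Len)) M<r
  ... | inj₁ e = inj₂ (trans e (trans (+-suc M M) (sym pos₂-top)))
  ... | inj₂ e = ⊥-elim (<-irrefl refl (<-trans (subst (_< Len) e p<Len) Len<p))
    where
    Len<p : Len < suc (suc (suc M + suc M))
    Len<p = s≤s (s≤s (+-mono-< (n<1+n M) (n<1+n M)))

  positions-of : ∀ p g → p < Len → rank p ⊓ M ≡ g → p ≡ pos₁ g ⊎ p ≡ pos₂ g
  positions-of p g p<Len eq with rank p <? M
  ... | yes r<M = inner-positions p (subst (_< M) r≡g r<M) r≡g
    where r≡g = trans (sym (m≤n⇒m⊓n≡m (<⇒≤ r<M))) eq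
  ... | no r≮M = subst (λ h → p ≡ pos₁ h ⊎ p ≡ pos₂ h) M≡g (top-positions p p<Len (≮⇒≥ r≮M))
    where M≡g = trans (sym (m≥n⇒m⊓n≡n (≮⇒≥ r≮M))) eq

  occurs : ∀ {x p} → p < Len → rank p ⊓ M ≡ toℕ x → OccursAt word x p
  occurs {x} {p} p<Len eq = i , toℕ-fromℕ< p<len , toℕ-injective vertex-i
    where
    p<len = subst (p <_) (sym (length-applyUpTo vertexAt Len)) p<Len
    i = fromℕ< p<len
    vertex-i : toℕ (lookup word i) ≡ toℕ x
    vertex-i = trans (toℕ-lookup i) (trans (cong (λ q → rank q ⊓ M) (toℕ-fromℕ< p<len)) eq)

  positions : (x : Vertex) → TwiceAt word x (pos₁ (toℕ x)) (pos₂ (toℕ x))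
  positions x = twiceAt (pos₁<pos₂ g≤M)
                        (occurs (<-trans (pos₁<pos₂ g≤M) (pos₂<Len {toℕ x})) (vertex-pos₁ g≤M))
                        (occurs (pos₂<Len {toℕ x}) (vertex-pos₂ g≤M))
                        (λ i ix → positions-of (toℕ i) (toℕ x) (pos<Len i)
                                    (trans (sym (toℕ-lookup i)) (cong toℕ ix)))
    where g≤M = ≤-pred (toℕ<n x)

  adjacent-interleave : ∀ {g} → suc g ≤ M →
    pos₁ g < pos₁ (suc g) × pos₁ (suc g) < pos₂ g × pos₂ g < pos₂ (suc g)
  adjacent-interleave {g} g<M rewrite pos₂-inner g<M =
      ≤-trans (s≤s (m∸n≤m (g + g) 1)) (≤-reflexive (sym (+-suc g g)))
    , ≤-reflexive (cong suc (+-suc g g))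
    , subst (_≤ pos₂ (suc g)) (cong (suc ∘ suc) (+-suc g g)) (pos₂-lower g<M)

  distant-before : ∀ {g h} → suc (suc g) ≤ h → pos₂ g < pos₁ h
  distant-before {g} {h} g+2≤h = ≤-<-trans (m⊓n≤m _ _) (subst (_≤ pos₁ h) 2g+3≡ (∸-monoˡ-≤ 1 4+2g≤2h))
    where
    4+2g≤2h = +-mono-≤ g+2≤h g+2≤h
    2g+3≡ : suc (g + suc (suc g)) ≡ suc (suc (suc (g + g)))
    2g+3≡ = cong suc (trans (+-suc g (suc g)) (cong suc (+-suc g g)))

  adjacent-alternate : (x y : Vertex) → suc (toℕ x) ≡ toℕ y → Alternate word x y
  adjacent-alternate x y e = alternate-if-interleaved (positions x) ty
                               (adjacent-interleave (subst (_≤ M) (sym e) (≤-pred (toℕ<n y))))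
    where
    ty : TwiceAt word y (pos₁ (suc (toℕ x))) (pos₂ (suc (toℕ x)))
    ty = subst₂ (TwiceAt word y) (cong pos₁ (sym e)) (cong pos₂ (sym e)) (positions y)

  distant-not-separated : (x y : Vertex) → suc (suc (toℕ x)) ≤ toℕ y → ¬ SeparatedBy word x y
  distant-not-separated x y far = not-separated-if-before (positions x) (positions y) (distant-before far)

  adjacent-or-distant : ∀ m n → ¬ m ≡ n →
    suc m ≡ n ⊎ suc n ≡ m ⊎ suc (suc m) ≤ n ⊎ suc (suc n) ≤ m
  adjacent-or-distant m n m≢n with <-cmp m n
  ... | tri≈ _ m≡n _ = ⊥-elim (m≢n m≡n)
  ... | tri< m<n _ _ = [ inj₂ ∘ inj₂ ∘ inj₁ , inj₁ ] (m≤n⇒m<n∨m≡n m<n)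
  ... | tri> _ _ n<m = [ inj₂ ∘ inj₂ ∘ inj₂ , inj₂ ∘ inj₁ ] (m≤n⇒m<n∨m≡n n<m)

  represents : Represents (PathEdge (suc M)) word
  represents x y x≢y = alternate⇒edge , edge⇒alternate
    where
    alternate⇒edge : Alternate word x y → PathEdge (suc M) x y
    alternate⇒edge alt with adjacent-or-distant (toℕ x) (toℕ y) (x≢y ∘ toℕ-injective)
    ... | inj₁ e               = inj₁ e
    ... | inj₂ (inj₁ e)        = inj₂ e
    ... | inj₂ (inj₂ (inj₁ far)) = ⊥-elim (distant-not-separated x y far (proj₁ alt))
    ... | inj₂ (inj₂ (inj₂ far)) = ⊥-elim (distant-not-separated y x far (proj₂ alt))
    edge⇒alternate : PathEdge (suc M) x y → Alternate word x y
    edge⇒alternate (inj₁ e) = adjacent-alternate x y e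
    edge⇒alternate (inj₂ e) = swap (adjacent-alternate y x e)

  two-uniform : TwoUniform (suc M) word
  two-uniform x = count-twice Fin._≟_ (positions x)

  label : Vertex → ℕ
  label v = M ∸ toℕ v

  label-injective : Injective _≡_ _≡_ label
  label-injective {x} {y} e = toℕ-injective (begin
    toℕ x            ≡⟨ sym (m∸[m∸n]≡n (≤-pred (toℕ<n x))) ⟩
    M ∸ label x      ≡⟨ cong (M ∸_) e ⟩
    M ∸ label y      ≡⟨ m∸[m∸n]≡n (≤-pred (toℕ<n y)) ⟩
    toℕ y            ∎)
    where open ≡-Reasoning

  rank-falls : (i j : Pos word) → label (lookup word i) < label (lookup word j) →
               rank (toℕ j) < rank (toℕ i)
  rank-falls i j rise with rank (toℕ j) <? rank (toℕ i)
  ... | yes fall = fall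
  ... | no no-fall = ⊥-elim (<⇒≱ rise′ (∸-monoʳ-≤ M (⊓-monoˡ-≤ M (≮⇒≥ no-fall))))
    where
    rise′ : M ∸ (rank (toℕ i) ⊓ M) < M ∸ (rank (toℕ j) ⊓ M)
    rise′ = subst₂ _<_ (cong (M ∸_) (toℕ-lookup i)) (cong (M ∸_) (toℕ-lookup j)) rise

  -- A 123 pattern would make rank fall twice, i.e. by two, contradicting rank-dip.
  avoids-123 : Avoids123 label word
  avoids-123 (i , j , k , i<j , j<k , rise₁ , rise₂) =
    <⇒≱ (<-≤-trans (s≤s (rank-falls j k rise₂)) (rank-falls i j rise₁)) (rank-dip (<-trans i<j j<k))

theorem4p2 : (n : ℕ) → n ≥ 1 →
    Σ (Fin n → ℕ) λ lab → ∃[ w ] (Injective _≡_ _≡_ lab × Represents (PathEdge n) w ×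
    Avoids123 lab w × TwoUniform n w)
theorem4p2 zero ()
theorem4p2 (suc M) _ = label , word , label-injective , represents , avoids-123 , two-uniform
  where open PathWord M
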